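{- Let $G$ be a graph, let $F$ be the edge set of a forest in $G$, and let $\Gamma$ be an abelian group. If $\varphi$ and $\psi$ are switching inequivalent $\Gamma$-gain functions on $G$, then the induced gain functions $\varphi|_{G/F}$ and $\psi|_{G/F}$ are switching inequivalent.
   Context: A $\Gamma$-gain function on $G$ assigns to each oriented edge $e$ a value $\varphi(e)\in\Gamma$ with $\varphi(e^{ -1})=\varphi(e)^{ -1}$. For $\eta:V(G)\to\Gamma$, $\varphi^\eta(e)=\eta(\mathrm{tail}\,e)^{ -1}\varphi(e)\eta(\mathrm{head}\,e)$; $\varphi$ and $\psi$ are switching equivalent if $\psi=\varphi^\eta$ for some $\eta$. The induced gain function on $G/F$ (defined up to switching) is obtained by switching $\varphi$ so that it takes the identity value on every edge of a maximal forest of $G$ containing $F$, and then restricting to $E(G)\setminus F$. -}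

module Defs where

open import Level using (Level; _⊔_)
open import Data.Nat using (ℕ; _≥_)
open import Data.Fin using (Fin)
open import Data.Fin.Subset using (Subset; _∈_; _∉_; _⊆_; _∪_; ⁅_⁆)
open import Data.List using (List; []; _∷_; length)
open import Data.List.Relation.Unary.Unique.Propositional using (Unique)
open import Data.Product using (Σ; Σ-syntax; ∃; ∃-syntax; _×_; _,_)
open import Relation.Nullary using (¬_)
open import Algebra.Bundles using (AbelianGroup)

-- Every edge e comes with a fixed
-- reference orientation tail e → head e; the opposite orientation e⁻¹
-- goes head e → tail e.
record Graph (n m : ℕ) : Set where
  field
    tail : Fin m → Fin n
    head : Fin m → Fin n
open Graph public

data Walk {n m : ℕ} (G : Graph n m) (S : Subset m) : Fin n → Fin n → Set where
  nil  : ∀ {v} → Walk G S v v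
  fwd  : ∀ {w} (e : Fin m) → e ∈ S → Walk G S (head G e) w → Walk G S (tail G e) w
  bwd  : ∀ {w} (e : Fin m) → e ∈ S → Walk G S (tail G e) w → Walk G S (head G e) w

walkEdges : ∀ {n m} {G : Graph n m} {S : Subset m} {u v : Fin n} → Walk G S u v → List (Fin m)
walkEdges nil = []
walkEdges (fwd e _ w) = e ∷ walkEdges w
walkEdges (bwd e _ w) = e ∷ walkEdges w

walkStarts : ∀ {n m} {G : Graph n m} {S : Subset m} {u v : Fin n} → Walk G S u v → List (Fin n)
walkStarts nil = []
walkStarts {u = u} (fwd e _ w) = u ∷ walkStarts w
walkStarts {u = u} (bwd e _ w) = u ∷ walkStarts w

-- A cycle in the edge set S: a closed walk v₀ e₁ v₁ … e_k v₀ with k ≥ 1,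
-- pairwise distinct edges and pairwise distinct vertices v₀,…,v_{k-1}.
-- (A loop is a cycle of length 1, two parallel edges form a cycle of length 2.)
HasCycle : ∀ {n m} → Graph n m → Subset m → Set
HasCycle {n} G S = Σ[ v ∈ Fin n ] Σ[ c ∈ Walk G S v v ]
  (length (walkEdges c) ≥ 1 × Unique (walkEdges c) × Unique (walkStarts c))

IsForest : ∀ {n m} → Graph n m → Subset m → Set
IsForest G S = ¬ HasCycle G S

IsMaximalForest : ∀ {n m} → Graph n m → Subset m → Set
IsMaximalForest {m = m} G T = IsForest G T × (∀ (e : Fin m) → e ∉ T → ¬ IsForest G (⁅ e ⁆ ∪ T))

module _ {c ℓ : Level} (Γ : AbelianGroup c ℓ) where
  open AbelianGroup Γ renaming (Carrier to Γ₀)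

  -- A Γ-gain function on G: its value φ e on the reference orientation of e;
  -- the value on e⁻¹ is (φ e)⁻¹ by definition.
  Gain : ℕ → Set c
  Gain m = Fin m → Γ₀

  gainInv : ∀ {m} → Gain m → Fin m → Γ₀
  gainInv φ e = (φ e) ⁻¹

  switch : ∀ {n m} → Graph n m → Gain m → (Fin n → Γ₀) → Gain m
  switch G φ η e = ((η (tail G e)) ⁻¹ ∙ φ e) ∙ η (head G e)

  SwitchingEquivalent : ∀ {n m} → Graph n m → Gain m → Gain m → Set (c ⊔ ℓ)
  SwitchingEquivalent {n} {m} G φ ψ =
    Σ[ η ∈ (Fin n → Γ₀) ] (∀ (e : Fin m) → ψ e ≈ switch G φ η e)

  -- Edges of G/F: the edges of G not in F (with endpoints the F-components
  -- of tail e and head e).  Vertices of G/F: the components of the spanning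
  -- subgraph (V(G), F).  A function on V(G/F) is therefore the same thing as
  -- a function η on V(G) that is constant on F-components, i.e. with
  -- η (tail f) ≈ η (head f) for every f ∈ F.

  ContractedEdge : ∀ {m} → Subset m → Set
  ContractedEdge {m} F = Σ[ e ∈ Fin m ] e ∉ F

  ContractedGain : ∀ {m} → Subset m → Set c
  ContractedGain F = ContractedEdge F → Γ₀

  ConstantOnComponents : ∀ {n m} → Graph n m → Subset m → (Fin n → Γ₀) → Set ℓ
  ConstantOnComponents {m = m} G F η = ∀ (f : Fin m) → f ∈ F → η (tail G f) ≈ η (head G f)

  SwitchingEquivalentContracted : ∀ {n m} → Graph n m → (F : Subset m) →
    ContractedGain F → ContractedGain F → Set (c ⊔ ℓ)
  SwitchingEquivalentContracted {n} G F φ' ψ' =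
    Σ[ η ∈ (Fin n → Γ₀) ] (ConstantOnComponents G F η ×
      (∀ (e : ContractedEdge F) → ψ' e ≈ ((η (tail G (Data.Product.proj₁ e))) ⁻¹ ∙ φ' e) ∙ η (head G (Data.Product.proj₁ e))))

  -- φ' is (a representative of) the induced gain function φ|_{G/F}:
  -- obtained by switching φ so that it is the identity on every edge of some
  -- maximal forest T ⊇ F of G, then restricting to E(G) ∖ F.
  IsInducedGain : ∀ {n m} → Graph n m → (F : Subset m) → Gain m → ContractedGain F → Set (c ⊔ ℓ)
  IsInducedGain {n} {m} G F φ φ' =
    Σ[ T ∈ Subset m ] Σ[ η ∈ (Fin n → Γ₀) ]
      (IsMaximalForest G T × F ⊆ T ×
       (∀ (e : Fin m) → e ∈ T → switch G φ η e ≈ ε) ×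
       (∀ (e : ContractedEdge F) → φ' e ≈ switch G φ η (Data.Product.proj₁ e)))

-- Switching is a group action of vertex functions on gain functions.  An induced
-- gain φ' is the restriction of some φ₁ = φ^η₁ that is trivial on F.  A switching
-- ψ' = φ'^η on G/F is a function η on V(G) constant on F-components, so it also
-- switches φ₁ to ψ₁ on the edges of F, where both are trivial.  Hence
-- φ ~ φ₁ ~ ψ₁ ~ ψ.
module Submission where

open import Defs
open import Level using (Level; _⊔_)
open import Data.Nat using (ℕ)
open import Data.Fin using (Fin)
open import Data.Fin.Subset using (Subset; _∈_)
open import Data.Fin.Subset.Properties using (_∈?_)
open import Data.Product using (Σ-syntax; _×_; _,_; proj₁)
open import Relation.Nullary using (¬_; yes; no)
open import Algebra.Bundles using (AbelianGroup)
import Algebra.Properties.AbelianGroup as AbelianGroupProperties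
import Algebra.Solver.Monoid as MonoidSolver
import Relation.Binary.Reasoning.Setoid as SetoidReasoning

module Switching {c ℓ : Level} (Γ : AbelianGroup c ℓ) {n m : ℕ} (G : Graph n m) where
  open AbelianGroup Γ renaming (Carrier to Γ₀)
  open AbelianGroupProperties Γ using (⁻¹-anti-homo-∙; ε⁻¹≈ε)
  open MonoidSolver monoid using (solve; _⊕_; _⊜_)
  open SetoidReasoning setoid

  switch-cong : ∀ (φ ψ : Gain Γ m) (η ζ : Fin n → Γ₀) →
    (∀ e → φ e ≈ ψ e) → (∀ v → η v ≈ ζ v) → ∀ e → switch Γ G φ η e ≈ switch Γ G ψ ζ e
  switch-cong _ _ _ _ φ≈ψ η≈ζ e =
    ∙-cong (∙-cong (⁻¹-cong (η≈ζ (tail G e))) (φ≈ψ e)) (η≈ζ (head G e))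

  switch-ε : ∀ (φ : Gain Γ m) e → switch Γ G φ (λ _ → ε) e ≈ φ e
  switch-ε φ e = begin
    (ε ⁻¹ ∙ φ e) ∙ ε  ≈⟨ identityʳ _ ⟩
    ε ⁻¹ ∙ φ e        ≈⟨ ∙-congʳ ε⁻¹≈ε ⟩
    ε ∙ φ e           ≈⟨ identityˡ _ ⟩
    φ e               ∎

  switch-∙ : ∀ (φ : Gain Γ m) (η ζ : Fin n → Γ₀) e →
    switch Γ G (switch Γ G φ η) ζ e ≈ switch Γ G φ (λ v → η v ∙ ζ v) e
  switch-∙ φ η ζ e = begin
    (ζ t ⁻¹ ∙ ((η t ⁻¹ ∙ φ e) ∙ η h)) ∙ ζ h
      ≈⟨ solve 5 (λ a b x p q → (a ⊕ ((b ⊕ x) ⊕ p)) ⊕ q ⊜ ((a ⊕ b) ⊕ x) ⊕ (p ⊕ q))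
           refl (ζ t ⁻¹) (η t ⁻¹) (φ e) (η h) (ζ h) ⟩
    ((ζ t ⁻¹ ∙ η t ⁻¹) ∙ φ e) ∙ (η h ∙ ζ h)
      ≈⟨ ∙-congʳ (∙-congʳ (sym (⁻¹-anti-homo-∙ (η t) (ζ t)))) ⟩
    ((η t ∙ ζ t) ⁻¹ ∙ φ e) ∙ (η h ∙ ζ h) ∎
    where
    t h : Fin n
    t = tail G e
    h = head G e

  switch-trivial : ∀ (φ : Gain Γ m) (η : Fin n → Γ₀) e →
    φ e ≈ ε → η (tail G e) ≈ η (head G e) → switch Γ G φ η e ≈ ε
  switch-trivial φ η e φe≈ε η-const = begin
    (η (tail G e) ⁻¹ ∙ φ e) ∙ η (head G e) ≈⟨ ∙-cong (∙-congˡ φe≈ε) (sym η-const) ⟩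
    (η (tail G e) ⁻¹ ∙ ε) ∙ η (tail G e)   ≈⟨ ∙-congʳ (identityʳ _) ⟩
    η (tail G e) ⁻¹ ∙ η (tail G e)         ≈⟨ inverseˡ _ ⟩
    ε                                      ∎

  _∼_ : Gain Γ m → Gain Γ m → Set (c ⊔ ℓ)
  _∼_ = SwitchingEquivalent Γ G

  ∼-switch : ∀ (φ : Gain Γ m) (η : Fin n → Γ₀) → φ ∼ switch Γ G φ η
  ∼-switch φ η = η , λ _ → refl

  ∼-sym : ∀ {φ ψ} → φ ∼ ψ → ψ ∼ φ
  ∼-sym {φ} {ψ} (η , ψ≈φ^η) = η⁻¹ , λ e → begin
    φ e                                 ≈⟨ sym (switch-ε φ e) ⟩
    switch Γ G φ (λ _ → ε) e            ≈⟨ switch-cong φ φ _ _ (λ _ → refl) (λ v → sym (inverseʳ (η v))) e ⟩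
    switch Γ G φ (λ v → η v ∙ η⁻¹ v) e  ≈⟨ sym (switch-∙ φ η η⁻¹ e) ⟩
    switch Γ G (switch Γ G φ η) η⁻¹ e   ≈⟨ switch-cong _ ψ η⁻¹ η⁻¹ (λ e′ → sym (ψ≈φ^η e′)) (λ _ → refl) e ⟩
    switch Γ G ψ η⁻¹ e                  ∎
    where
    η⁻¹ : Fin n → Γ₀
    η⁻¹ v = η v ⁻¹

  ∼-trans : ∀ {φ ψ χ} → φ ∼ ψ → ψ ∼ χ → φ ∼ χ
  ∼-trans {φ} {ψ} {χ} (η , ψ≈φ^η) (ζ , χ≈ψ^ζ) = (λ v → η v ∙ ζ v) , λ e → begin
    χ e                              ≈⟨ χ≈ψ^ζ e ⟩
    switch Γ G ψ ζ e                 ≈⟨ switch-cong ψ _ ζ ζ ψ≈φ^η (λ _ → refl) e ⟩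
    switch Γ G (switch Γ G φ η) ζ e  ≈⟨ switch-∙ φ η ζ e ⟩
    switch Γ G φ (λ v → η v ∙ ζ v) e ∎

  module _ (F : Subset m) where

    TrivialOn : Gain Γ m → Set ℓ
    TrivialOn φ = ∀ f → f ∈ F → φ f ≈ ε

    Restricts : Gain Γ m → ContractedGain Γ F → Set ℓ
    Restricts φ φ′ = ∀ (e : ContractedEdge Γ F) → φ′ e ≈ φ (proj₁ e)

    inducedGain-representative : ∀ {φ φ′} → IsInducedGain Γ G F φ φ′ →
      Σ[ φ₁ ∈ Gain Γ m ] (φ ∼ φ₁ × TrivialOn φ₁ × Restricts φ₁ φ′)
    inducedGain-representative {φ} (_ , η , _ , F⊆T , trivialOnT , φ′≈) =
      switch Γ G φ η , ∼-switch φ η , (λ f f∈F → trivialOnT f (F⊆T f∈F)) , φ′≈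

    switchingEquivalentContracted-lift : ∀ {φ ψ φ′ ψ′} →
      TrivialOn φ → TrivialOn ψ → Restricts φ φ′ → Restricts ψ ψ′ →
      SwitchingEquivalentContracted Γ G F φ′ ψ′ → φ ∼ ψ
    switchingEquivalentContracted-lift {φ} {ψ} {φ′} {ψ′}
      φ-trivial ψ-trivial φ′≈ ψ′≈ (η , η-const , ψ′≈φ′^η) = η , ψ≈φ^η
      where
      ψ≈φ^η : ∀ e → ψ e ≈ switch Γ G φ η e
      ψ≈φ^η e with e ∈? F
      ... | yes e∈F = trans (ψ-trivial e e∈F)
                        (sym (switch-trivial φ η e (φ-trivial e e∈F) (η-const e e∈F)))
      ... | no e∉F = begin
        ψ e                 ≈⟨ sym (ψ′≈ (e , e∉F)) ⟩
        ψ′ (e , e∉F)        ≈⟨ ψ′≈φ′^η (e , e∉F) ⟩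
        (η (tail G e) ⁻¹ ∙ φ′ (e , e∉F)) ∙ η (head G e)
                            ≈⟨ ∙-congʳ (∙-congˡ (φ′≈ (e , e∉F))) ⟩
        switch Γ G φ η e    ∎

mainTheorem8 : ∀ {c ℓ : Level} (Γ : AbelianGroup c ℓ) {n m : ℕ} (G : Graph n m)
    (F : Subset m) → IsForest G F →
    (φ ψ : Gain Γ m) → ¬ SwitchingEquivalent Γ G φ ψ →
    (φ' ψ' : ContractedGain Γ F) →
    IsInducedGain Γ G F φ φ' → IsInducedGain Γ G F ψ ψ' →
    ¬ SwitchingEquivalentContracted Γ G F φ' ψ'
mainTheorem8 Γ G F _ φ ψ φ≁ψ φ' ψ' φ'-induced ψ'-induced φ'∼ψ' = φ≁ψ φ∼ψ
  where
  open Switching Γ G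
  φ∼ψ : φ ∼ ψ
  φ∼ψ with inducedGain-representative F φ'-induced | inducedGain-representative F ψ'-induced
  ... | φ₁ , φ∼φ₁ , φ₁-trivial , φ₁↾φ' | ψ₁ , ψ∼ψ₁ , ψ₁-trivial , ψ₁↾ψ' =
    ∼-trans φ∼φ₁ (∼-trans φ₁∼ψ₁ (∼-sym ψ∼ψ₁))
    where
    φ₁∼ψ₁ : φ₁ ∼ ψ₁
    φ₁∼ψ₁ = switchingEquivalentContracted-lift F φ₁-trivial ψ₁-trivial φ₁↾φ' ψ₁↾ψ' φ'∼ψ'
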